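{- Let $E$ be an arc set on nodes $0_0,\dots,0_n$ with $E\subseteq\{(0_i,0_j):0\le i<j\le n\}$ satisfying: (a) if $(0_i,0_j)\in E$ and $i+1<j$ then $(0_{i+1},0_j)\in E$; (b) if $(0_i,0_j)\notin E$ and $j<n$ then $(0_i,0_{j+1})\notin E$; (c) $(0_i,0_{i+1})\in E$ for all $0\le i<n$. Run the queue-based split algorithm described in the context on the graph $(\{0_0,\dots,0_n\},E,c)$. Then for every $x=1,\dots,n$, at the moment $pot[x]$ is assigned, the node $0_{\Lambda.front}$ is an optimal predecessor of $0_x$; that is, $(0_{\Lambda.front},0_x)\in E$ and $pot[x]=pot[\Lambda.front]+c(\Lambda.front,x)$ equals the minimum weight of a directed path from $0_0$ to $0_x$ in this graph.
   Context: Customers $1,\dots,n$ in tour order, depot $0$, arc costs $c_{u,v}\ge0$. Let $C[0]=0$ and $C[k]=C[k-1]+c_{k-1,k}$ for $1\le k\le n$. The weight of arc $(0_i,0_j)$ is $c(i,j)=c_{0,i+1}+C[j]-C[i+1]+c_{j,0}$ (cost of the route serving customers $i+1,\dots,j$). Given values $pot[\cdot]$, define $dominates(i,j)$ for $i<j<n$ to be true iff $pot[i]+c_{0,i+1}+C[j+1]-C[i+1]<pot[j]+c_{0,j+1}$. The algorithm: set $pot[0]=0$ and let $\Lambda$ be an empty double-ended queue. For $x=1,\dots,n$: while $\Lambda$ is nonempty and $dominates(\Lambda.back,x-1)$ is false, remove the back element; insert $x-1$ at the back; while $(0_{\Lambda.front},0_x)\notin E$, remove the front element; then set $pot[x]=pot[\Lambda.front]+c(\Lambda.front,x)$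 and $pred[x]=\Lambda.front$.
   Formalization: The arc costs $c_{u,v}$ are rational, so the prefix sums, arc weights, potentials and path weights are rational as well. -}

module Defs where

open import Data.Nat using (ℕ; zero; suc; _∸_; _≡ᵇ_)
open import Data.Bool using (Bool; true; false; not; if_then_else_)
open import Data.List using (List; []; _∷_; _++_; reverse; dropWhileᵇ)
open import Data.Rational using (ℚ; 0ℚ; _+_; _-_; _≤_; _<_)
open import Data.Rational.Properties using (_<?_)
open import Relation.Nullary.Decidable using (⌊_⌋)
open import Data.Product using (Σ; _×_)
open import Relation.Binary.PropositionalEquality using (_≡_)

-- Data of an instance: arc costs c u v (nodes 0 = depot, 1..n = customers)
-- and the arc set E of the auxiliary graph on nodes 0_0,...,0_n,
-- given as a Boolean membership test: E i j ≡ true  iff  (0_i,0_j) ∈ E.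
Cost : Set
Cost = ℕ → ℕ → ℚ

ArcSet : Set
ArcSet = ℕ → ℕ → Bool

C : Cost → ℕ → ℚ
C c zero    = 0ℚ
C c (suc k) = C c k + c k (suc k)

arcCost : Cost → ℕ → ℕ → ℚ
arcCost c i j = c 0 (suc i) + (C c j - C c (suc i)) + c j 0

dominates : Cost → (ℕ → ℚ) → ℕ → ℕ → Bool
dominates c pot i j =
  ⌊ (pot i + c 0 (suc i) + (C c (suc j) - C c (suc i))) <? (pot j + c 0 (suc j)) ⌋

-- Algorithm state: current potentials and the double-ended queue Λ
-- (a list whose head is Λ.front and whose last element is Λ.back).
record State : Set where
  constructor st
  field
    pot : ℕ → ℚ
    Λ   : List ℕ
open State public

dropBackWhileᵇ : (ℕ → Bool) → List ℕ → List ℕ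
dropBackWhileᵇ p xs = reverse (dropWhileᵇ p (reverse xs))

queueAfterBack : Cost → ℕ → State → List ℕ
queueAfterBack c x s =
  dropBackWhileᵇ (λ b → not (dominates c (pot s) b (x ∸ 1))) (Λ s) ++ (x ∸ 1 ∷ [])

queueAfterFront : Cost → ArcSet → ℕ → State → List ℕ
queueAfterFront c E x s = dropWhileᵇ (λ i → not (E i x)) (queueAfterBack c x s)

update : (ℕ → ℚ) → ℕ → ℚ → ℕ → ℚ
update f x v y = if y ≡ᵇ x then v else f y

-- One iteration x: pot[x] := pot[front] + c(front,x).
-- (If the queue were empty the potentials are left unchanged; the theorem
-- asserts that this never happens.)
step : Cost → ArcSet → ℕ → State → State
step c E x s with queueAfterFront c E x s
... | []        = st (pot s) []
... | (f ∷ q)   = st (update (pot s) x (pot s f + arcCost c f x)) (f ∷ q)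

run : Cost → ArcSet → ℕ → State
run c E zero    = st (λ _ → 0ℚ) []
run c E (suc k) = step c E (suc k) (run c E k)

data Path (E : ArcSet) : ℕ → ℕ → Set where
  here : ∀ {i} → Path E i i
  arc  : ∀ {i j k} → E i j ≡ true → Path E j k → Path E i k

weight : ∀ {E i k} → Cost → Path E i k → ℚ
weight c here = 0ℚ
weight c (arc {i} {j} _ p) = arcCost c i j + weight c p

IsMinPathWeight : Cost → ArcSet → ℕ → ℕ → ℚ → Set
IsMinPathWeight c E s t v =
  Σ (Path E s t) (λ p → weight c p ≡ v) × ((p : Path E s t) → v ≤ weight c p)

-- Let dist x be the potential assigned to 0_x and key i = dist i + c_{0,i+1} - C[i+1].
-- Then dist i + c(i,x) = key i + C[x] + c_{x,0}, so an optimal predecessor of 0_x is an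
-- in-neighbour of minimal key, and dominates(i,j) says exactly key i < key j. The queue
-- stays strictly increasing in key, and every earlier node i with an arc to the current node
-- or beyond is represented in it by some q ≥ i with key q ≤ key i; by (a) and (b) such
-- a q inherits the arc from i to the next node. Hence, once the fronts without an arc to
-- 0_x are dropped, the front is an in-neighbour of 0_x of minimal key, and Bellman's
-- equation on this acyclic graph makes pot[x] the minimum path weight.

module Submission where

open import Defs
open import Data.Nat using (ℕ; suc; _<_; _≤_; _∸_)
open import Data.Bool using (true; false)
open import Data.List using (List; _∷_)
open import Data.Product using (Σ; _×_)
open import Data.Rational using (ℚ; 0ℚ; _+_) renaming (_≤_ to _≤ℚ_)
open import Relation.Binary.PropositionalEquality using (_≡_)

open import Data.Nat using (zero; z≤n; _≤′_; ≤′-refl; ≤′-step; _≡ᵇ_)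
import Data.Nat.Properties as ℕ
open import Data.Bool using (Bool; not; T)
open import Data.Bool.Properties using (T-≡)
open import Data.Sum using (_⊎_; inj₁; inj₂)
open import Data.Product using (∃; _,_; proj₁; proj₂)
open import Data.List using ([]; _++_; _∷ʳ_; reverse; takeWhileᵇ; dropWhileᵇ; head; initLast; _∷ʳ′_)
open import Data.List.Properties using (takeWhile++dropWhile; reverse-involutive; reverse-++; reverse-selfInverse)
open import Data.List.Relation.Unary.All as All using (All; []; _∷_)
import Data.List.Relation.Unary.All.Properties as All
open import Data.List.Relation.Unary.AllPairs using (AllPairs; []; _∷_)
import Data.List.Relation.Unary.AllPairs.Properties as AllPairs
open import Data.List.Relation.Unary.Any using (here; there)
open import Data.List.Relation.Unary.Any.Properties using (reverse⁻)
open import Data.List.Membership.Propositional using (_∈_)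
open import Data.List.Membership.Propositional.Properties using (∈-++⁺ˡ; ∈-++⁺ʳ; ∈-++⁻)
import Data.Maybe.Relation.Unary.All as Maybe
open import Data.Rational using (_-_; -_) renaming (_<_ to _<ℚ_)
import Data.Rational.Properties as ℚ
open import Data.Rational.Solver using (module +-*-Solver)
open import Function using (_∘_; Equivalence)
open import Level using (0ℓ)
open import Relation.Binary using (Rel; Transitive)
open import Relation.Binary.PropositionalEquality using (refl; sym; trans; cong; subst; subst₂; _≢_; module ≡-Reasoning)
open import Relation.Nullary using (¬_; contradiction)
open import Relation.Nullary.Decidable using (T?; toWitness; toWitnessFalse)

¬T-not⇒T : ∀ {b} → ¬ T (not b) → T b
¬T-not⇒T {true}  _ = _
¬T-not⇒T {false} h = h _

module _ {a} {A : Set a} (p : A → Bool) where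

  takeWhileᵇ++dropWhileᵇ : ∀ xs → xs ≡ takeWhileᵇ p xs ++ dropWhileᵇ p xs
  takeWhileᵇ++dropWhileᵇ xs = sym (takeWhile++dropWhile (T? ∘ p) xs)

  ∈-dropWhileᵇ : ∀ {x xs} → x ∈ xs → ¬ T (p x) → x ∈ dropWhileᵇ p xs
  ∈-dropWhileᵇ {x} {xs} x∈xs ¬px
    with ∈-++⁻ (takeWhileᵇ p xs) (subst (x ∈_) (takeWhileᵇ++dropWhileᵇ xs) x∈xs)
  ... | inj₁ x∈taken = contradiction (All.lookup (All.all-takeWhile (T? ∘ p) xs) x∈taken) ¬px
  ... | inj₂ x∈kept  = x∈kept

  dropWhileᵇ-head : ∀ xs {y ys} → dropWhileᵇ p xs ≡ y ∷ ys → ¬ T (p y)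
  dropWhileᵇ-head xs eq with subst (Maybe.All _ ∘ head) eq (All.all-head-dropWhile (T? ∘ p) xs)
  ... | Maybe.just ¬py = ¬py

module _ (p : ℕ → Bool) where

  dropBackWhileᵇ-++ : ∀ xs → ∃ λ ds → All (T ∘ p) ds × xs ≡ dropBackWhileᵇ p xs ++ ds
  dropBackWhileᵇ-++ xs =
    reverse taken , All.tabulate (All.lookup (All.all-takeWhile (T? ∘ p) (reverse xs)) ∘ reverse⁻) , xs≡
    where
    taken kept : List ℕ
    taken = takeWhileᵇ p (reverse xs)
    kept  = dropWhileᵇ p (reverse xs)
    open ≡-Reasoning
    xs≡ : xs ≡ reverse kept ++ reverse taken
    xs≡ = begin
      xs                         ≡⟨ sym (reverse-involutive xs) ⟩
      reverse (reverse xs)       ≡⟨ cong reverse (takeWhileᵇ++dropWhileᵇ p (reverse xs)) ⟩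
      reverse (taken ++ kept)    ≡⟨ reverse-++ taken kept ⟩
      reverse kept ++ reverse taken ∎

  dropBackWhileᵇ-last : ∀ xs {ys y} → dropBackWhileᵇ p xs ≡ ys ∷ʳ y → ¬ T (p y)
  dropBackWhileᵇ-last xs {ys} {y} eq =
    dropWhileᵇ-head p (reverse xs) (trans (sym (reverse-selfInverse eq)) (reverse-++ ys (y ∷ [])))

module _ {a ℓ} {A : Set a} {R : Rel A ℓ} where

  AllPairs-++⁻ : ∀ xs {ys} → AllPairs R (xs ++ ys) → AllPairs R xs × AllPairs R ys
  AllPairs-++⁻ []       rys          = [] , rys
  AllPairs-++⁻ (x ∷ xs) (rx ∷ rxsys) =
    (All.++⁻ˡ xs rx ∷ proj₁ (AllPairs-++⁻ xs rxsys)) , proj₂ (AllPairs-++⁻ xs rxsys)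

  AllPairs-dropWhileᵇ⁺ : ∀ p {xs} → AllPairs R xs → AllPairs R (dropWhileᵇ p xs)
  AllPairs-dropWhileᵇ⁺ p {xs} rxs =
    proj₂ (AllPairs-++⁻ (takeWhileᵇ p xs) (subst (AllPairs R) (takeWhileᵇ++dropWhileᵇ p xs) rxs))

  AllPairs-head : ∀ {x xs y} → AllPairs R (x ∷ xs) → y ∈ x ∷ xs → x ≡ y ⊎ R x y
  AllPairs-head _          (here refl) = inj₁ refl
  AllPairs-head (rx ∷ _)   (there y∈xs) = inj₂ (All.lookup rx y∈xs)

  module _ (R-trans : Transitive R) where

    All-R-∷ʳ : ∀ xs {y z} → AllPairs R (xs ∷ʳ y) → R y z → All (λ x → R x z) (xs ∷ʳ y)
    All-R-∷ʳ []       _          ryz = ryz ∷ []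
    All-R-∷ʳ (x ∷ xs) (rx ∷ rxs) ryz with All.++⁻ʳ xs rx
    ... | rxy ∷ [] = R-trans rxy ryz ∷ All-R-∷ʳ xs rxs ryz

    AllPairs-∷ʳ⁺ : ∀ xs {z} → AllPairs R xs → (∀ {ys y} → xs ≡ ys ∷ʳ y → R y z) → AllPairs R (xs ∷ʳ z)
    AllPairs-∷ʳ⁺ xs rxs last-R with initLast xs
    ... | []       = [] ∷ []
    ... | ys ∷ʳ′ y =
      AllPairs.++⁺ rxs ([] ∷ []) (All.map (_∷ []) (All-R-∷ʳ ys rxs (last-R refl)))

module _ (r : ℚ) {p q : ℚ} where

  private
    +-−-cancelʳ : ∀ x → x + r - r ≡ x
    +-−-cancelʳ x = solve 2 (λ x r → x :+ r :- r := x) refl x r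
      where open +-*-Solver

  +-cancelʳ-< : p + r <ℚ q + r → p <ℚ q
  +-cancelʳ-< h = subst₂ _<ℚ_ (+-−-cancelʳ p) (+-−-cancelʳ q) (ℚ.+-monoˡ-< (- r) h)

  +-cancelʳ-≤ : p + r ≤ℚ q + r → p ≤ℚ q
  +-cancelʳ-≤ h = subst₂ _≤ℚ_ (+-−-cancelʳ p) (+-−-cancelʳ q) (ℚ.+-monoˡ-≤ (- r) h)

module _ (c : Cost) where

  reducedPot : (ℕ → ℚ) → ℕ → ℚ
  reducedPot pt i = pt i + c 0 (suc i) - C c (suc i)

  private
    open +-*-Solver

    dominated-side : ∀ (pt : ℕ → ℚ) j → pt j + c 0 (suc j) ≡ reducedPot pt j + C c (suc j)
    dominated-side pt j =
      solve 3 (λ p a t → p :+ a := (p :+ a :- t) :+ t) refl (pt j) (c 0 (suc j)) (C c (suc j))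

    dominating-side : ∀ (pt : ℕ → ℚ) i j →
      pt i + c 0 (suc i) + (C c (suc j) - C c (suc i)) ≡ reducedPot pt i + C c (suc j)
    dominating-side pt i j =
      solve 4 (λ p a s t → p :+ a :+ (t :- s) := (p :+ a :- s) :+ t) refl
        (pt i) (c 0 (suc i)) (C c (suc i)) (C c (suc j))

    reducedPot-arcCost : ∀ (pt : ℕ → ℚ) i x → pt i + arcCost c i x ≡ reducedPot pt i + (C c x + c x 0)
    reducedPot-arcCost pt i x =
      solve 5 (λ p a s t b → p :+ (a :+ (t :- s) :+ b) := (p :+ a :- s) :+ (t :+ b)) refl
        (pt i) (c 0 (suc i)) (C c (suc i)) (C c x) (c x 0)

  reducedPot-≤⇒arcCost-≤ : ∀ pt {f i} x → reducedPot pt f ≤ℚ reducedPot pt i →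
    pt f + arcCost c f x ≤ℚ pt i + arcCost c i x
  reducedPot-≤⇒arcCost-≤ pt {f} {i} x f≤i =
    subst₂ _≤ℚ_ (sym (reducedPot-arcCost pt f x)) (sym (reducedPot-arcCost pt i x))
      (ℚ.+-monoˡ-≤ (C c x + c x 0) f≤i)

  dominates⇒< : ∀ pt i j → T (dominates c pt i j) → reducedPot pt i <ℚ reducedPot pt j
  dominates⇒< pt i j d =
    +-cancelʳ-< (C c (suc j)) (subst₂ _<ℚ_ (dominating-side pt i j) (dominated-side pt j) (toWitness d))

  ¬dominates⇒≥ : ∀ pt i j → T (not (dominates c pt i j)) → reducedPot pt j ≤ℚ reducedPot pt i
  ¬dominates⇒≥ pt i j d =
    +-cancelʳ-≤ (C c (suc j))
      (subst₂ _≤ℚ_ (dominated-side pt j) (dominating-side pt i j) (ℚ.≮⇒≥ (toWitnessFalse d)))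

module _ (c : Cost) (E : ArcSet) where

  step-pot-≢ : ∀ x s {y} → y ≢ x → pot (step c E x s) y ≡ pot s y
  step-pot-≢ x s {y} y≢x with queueAfterFront c E x s
  ... | []    = refl
  ... | _ ∷ _ with y ≡ᵇ x in y≡ᵇx
  ...   | false = refl
  ...   | true  = contradiction (ℕ.≡ᵇ⇒≡ y x (subst T (sym y≡ᵇx) _)) y≢x

  step-front : ∀ x s {f q} → queueAfterFront c E x s ≡ f ∷ q →
    pot (step c E x s) x ≡ pot s f + arcCost c f x × Λ (step c E x s) ≡ f ∷ q
  step-front x s eq rewrite eq | Equivalence.to T-≡ (ℕ.≡⇒≡ᵇ x x refl) = refl , refl

  pot-run-stable : ∀ {k y} → y ≤ k → pot (run c E k) y ≡ pot (run c E y) y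
  pot-run-stable {zero}  z≤n  = refl
  pot-run-stable {suc k} y≤1+k with ℕ.m≤n⇒m<n∨m≡n y≤1+k
  ... | inj₂ refl = refl
  ... | inj₁ y<1+k =
    trans (step-pot-≢ (suc k) (run c E k) (ℕ.<⇒≢ y<1+k)) (pot-run-stable (ℕ.≤-pred y<1+k))

  infixl 5 _▷_

  _▷_ : ∀ {s i t} → Path E s i → E i t ≡ true → Path E s t
  here     ▷ e = arc e here
  arc e′ p ▷ e = arc e′ (p ▷ e)

  weight-▷ : ∀ {s i t} (p : Path E s i) (e : E i t ≡ true) →
    weight c (p ▷ e) ≡ weight c p + arcCost c i t
  weight-▷ {s} {_} {t} here e = trans (ℚ.+-identityʳ (arcCost c s t)) (sym (ℚ.+-identityˡ (arcCost c s t)))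
  weight-▷ {i = i} {t} (arc {s} {j} e′ p) e =
    trans (cong (arcCost c s j +_) (weight-▷ p e)) (sym (ℚ.+-assoc (arcCost c s j) (weight c p) (arcCost c i t)))

  arc-as-▷ : ∀ {s j t} (e : E s j ≡ true) (p : Path E j t) →
    ∃ λ i → Σ (Path E s i) λ p′ → Σ (E i t ≡ true) λ e′ → arc e p ≡ p′ ▷ e′
  arc-as-▷ {s} e here = s , here , e , refl
  arc-as-▷ e (arc e′ p) with arc-as-▷ e′ p
  ... | i , p′ , e″ , eq = i , arc e p′ , e″ , cong (arc e) eq

  Path-≤ : (∀ i j → E i j ≡ true → i < j) → ∀ {s t} → Path E s t → s ≤ t
  Path-≤ E-up here      = ℕ.≤-refl
  Path-≤ E-up (arc e p) = ℕ.≤-trans (ℕ.<⇒≤ (E-up _ _ e)) (Path-≤ E-up p)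

  minPathWeight-refl : (∀ i j → E i j ≡ true → i < j) → ∀ s → IsMinPathWeight c E s s 0ℚ
  minPathWeight-refl E-up s = (here , refl) , lower
    where
    lower : (p : Path E s s) → 0ℚ ≤ℚ weight c p
    lower here      = ℚ.≤-refl
    lower (arc e p) = contradiction (ℕ.<-≤-trans (E-up _ _ e) (Path-≤ E-up p)) (ℕ.<-irrefl refl)

  bellman : ∀ {s t f} (d : ℕ → ℚ) → s ≢ t → E f t ≡ true → IsMinPathWeight c E s f (d f) →
    (∀ {i} → E i t ≡ true → IsMinPathWeight c E s i (d i) × d f + arcCost c f t ≤ℚ d i + arcCost c i t) →
    IsMinPathWeight c E s t (d f + arcCost c f t)
  bellman {s} {t} {f} d s≢t e ((p , wp) , _) best =
    (p ▷ e , trans (weight-▷ p e) (cong (_+ arcCost c f t) wp)) , lower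
    where
    open ℚ.≤-Reasoning
    lower : (q : Path E s t) → d f + arcCost c f t ≤ℚ weight c q
    lower here = contradiction refl s≢t
    lower (arc e₁ q) with arc-as-▷ e₁ q
    ... | i , q′ , e′ , q≡ = begin
      d f + arcCost c f t        ≤⟨ proj₂ (best e′) ⟩
      d i + arcCost c i t        ≤⟨ ℚ.+-monoˡ-≤ (arcCost c i t) (proj₂ (proj₁ (best e′)) q′) ⟩
      weight c q′ + arcCost c i t ≡⟨ sym (weight-▷ q′ e′) ⟩
      weight c (q′ ▷ e′)          ≡⟨ cong (weight c) (sym q≡) ⟩
      weight c (arc e₁ q)         ∎

module ArcClosure {n : ℕ} {E : ArcSet}
  (E-bounded : ∀ i j → E i j ≡ true → i < j × j ≤ n)
  (E-shortenˡ : ∀ i j → E i j ≡ true → suc i < j → E (suc i) j ≡ true)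
  (E-shortenʳ : ∀ i j → i < j → E i j ≡ false → j < n → E i (suc j) ≡ false) where

  arc-shortenˡ : ∀ {i q x} → E i x ≡ true → i ≤ q → q < x → E q x ≡ true
  arc-shortenˡ {i} {x = x} e i≤q = go (ℕ.≤⇒≤′ i≤q)
    where
    go : ∀ {q} → i ≤′ q → q < x → E q x ≡ true
    go ≤′-refl        _     = e
    go (≤′-step i≤′q) 1+q<x = E-shortenˡ _ _ (go i≤′q (ℕ.<-trans (ℕ.n<1+n _) 1+q<x)) 1+q<x

  arc-shortenʳ-step : ∀ {q x} → E q (suc x) ≡ true → q < x → E q x ≡ true
  arc-shortenʳ-step {q} {x} e q<x with E q x in eq
  ... | true  = refl
  ... | false = contradiction (trans (sym (E-shortenʳ q x q<x eq (proj₂ (E-bounded q (suc x) e)))) e) λ ()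

  arc-shortenʳ : ∀ {q x x′} → E q x′ ≡ true → q < x → x ≤ x′ → E q x ≡ true
  arc-shortenʳ {q} {x} e q<x x≤x′ = go e (ℕ.≤⇒≤′ x≤x′)
    where
    go : ∀ {x′} → E q x′ ≡ true → x ≤′ x′ → E q x ≡ true
    go e ≤′-refl         = e
    go e (≤′-step x≤′x′) = go (arc-shortenʳ-step e (ℕ.<-≤-trans q<x (ℕ.≤′⇒≤ x≤′x′))) x≤′x′

module SplitQueue (n : ℕ) (c : Cost) (E : ArcSet)
  (E-bounded : ∀ i j → E i j ≡ true → i < j × j ≤ n)
  (E-shortenˡ : ∀ i j → E i j ≡ true → suc i < j → E (suc i) j ≡ true)
  (E-shortenʳ : ∀ i j → i < j → E i j ≡ false → j < n → E i (suc j) ≡ false)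
  (E-consecutive : ∀ i → i < n → E i (suc i) ≡ true) where

  open ArcClosure E-bounded E-shortenˡ E-shortenʳ

  dist : ℕ → ℚ
  dist x = pot (run c E x) x

  key : ℕ → ℚ
  key = reducedPot c dist

  _≺_ : Rel ℕ 0ℓ
  i ≺ j = key i <ℚ key j

  key-run : ∀ {k i} → i ≤ k → reducedPot c (pot (run c E k)) i ≡ key i
  key-run {k} {i} i≤k = cong (λ v → v + c 0 (suc i) - C c (suc i)) (pot-run-stable c E i≤k)

  Covers : ℕ → List ℕ → Set
  Covers k L = ∀ {i x} → i < k → k ≤ x → E i x ≡ true → ∃ λ q → q ∈ L × i ≤ q × key q ≤ℚ key i

  record QueueInvariant (k : ℕ) (L : List ℕ) : Set where
    field
      bounded : All (_< k) L
      sorted  : AllPairs _≺_ L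
      covers  : Covers k L

  back-invariant : ∀ {k} → QueueInvariant k (Λ (run c E k)) →
    QueueInvariant (suc k) (queueAfterBack c (suc k) (run c E k))
  back-invariant {k} inv = record { bounded = bounded′ ; sorted = sorted′ ; covers = covers′ }
    where
    open QueueInvariant inv
    L : List ℕ
    L = Λ (run c E k)

    pt : ℕ → ℚ
    pt = pot (run c E k)

    undominated : ℕ → Bool
    undominated b = not (dominates c pt b k)

    kept dropped : List ℕ
    kept    = dropBackWhileᵇ undominated L
    dropped = proj₁ (dropBackWhileᵇ-++ undominated L)

    dropped-undominated : All (T ∘ undominated) dropped
    dropped-undominated = proj₁ (proj₂ (dropBackWhileᵇ-++ undominated L))

    L≡ : L ≡ kept ++ dropped
    L≡ = proj₂ (proj₂ (dropBackWhileᵇ-++ undominated L))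

    kept-bounded : All (_< k) kept
    kept-bounded = All.++⁻ˡ kept (subst (All (_< k)) L≡ bounded)

    k∈ : k ∈ kept ∷ʳ k
    k∈ = ∈-++⁺ʳ kept (here refl)

    bounded′ : All (_< suc k) (kept ∷ʳ k)
    bounded′ = All.++⁺ (All.map ℕ.m<n⇒m<1+n kept-bounded) (ℕ.n<1+n k ∷ [])

    last≺k : ∀ {ys y} → kept ≡ ys ∷ʳ y → y ≺ k
    last≺k {ys} {y} eq = subst₂ _<ℚ_ (key-run y≤k) (key-run {k} ℕ.≤-refl)
      (dominates⇒< c pt y k (¬T-not⇒T (dropBackWhileᵇ-last undominated L eq)))
      where
      y≤k : y ≤ k
      y≤k = ℕ.<⇒≤ (All.lookup kept-bounded (subst (y ∈_) (sym eq) (∈-++⁺ʳ ys (here refl))))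

    sorted′ : AllPairs _≺_ (kept ∷ʳ k)
    sorted′ = AllPairs-∷ʳ⁺ ℚ.<-trans kept (proj₁ (AllPairs-++⁻ kept (subst (AllPairs _≺_) L≡ sorted))) last≺k

    covers′ : Covers (suc k) (kept ∷ʳ k)
    covers′ i<1+k 1+k≤x e with ℕ.m≤n⇒m<n∨m≡n (ℕ.≤-pred i<1+k)
    ... | inj₂ refl = k , k∈ , ℕ.≤-refl , ℚ.≤-refl
    ... | inj₁ i<k with covers i<k (ℕ.<⇒≤ 1+k≤x) e
    ...   | q , q∈L , i≤q , q≤i with ∈-++⁻ kept (subst (q ∈_) L≡ q∈L)
    ...     | inj₁ q∈kept    = q , ∈-++⁺ˡ q∈kept , i≤q , q≤i
    ...     | inj₂ q∈dropped = k , k∈ , ℕ.<⇒≤ i<k , ℚ.≤-trans k≤q q≤i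
      where
      k≤q : key k ≤ℚ key q
      k≤q = subst₂ _≤ℚ_ (key-run {k} ℕ.≤-refl) (key-run (ℕ.<⇒≤ (All.lookup bounded q∈L)))
        (¬dominates⇒≥ c pt q k (All.lookup dropped-undominated q∈dropped))

  noArcTo : ℕ → ℕ → Bool
  noArcTo x i = not (E i x)

  record FrontChoice (k : ℕ) (L : List ℕ) : Set where
    field
      front     : ℕ
      rest      : List ℕ
      queue≡    : dropWhileᵇ (noArcTo (suc k)) L ≡ front ∷ rest
      front-arc : E front (suc k) ≡ true
      front-min : ∀ {i} → E i (suc k) ≡ true → key front ≤ℚ key i
      invariant : QueueInvariant (suc k) (front ∷ rest)

  front-choice : ∀ {k L} → k < n → QueueInvariant (suc k) L → FrontChoice k L
  front-choice {k} {L} k<n inv = choose (dropWhileᵇ (noArcTo (suc k)) L) refl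
    where
    open QueueInvariant inv
    L″ : List ℕ
    L″ = dropWhileᵇ (noArcTo (suc k)) L

    covers″ : Covers (suc k) L″
    covers″ {i} {x} i<1+k 1+k≤x e with covers i<1+k 1+k≤x e
    ... | q , q∈L , i≤q , q≤i = q , q∈L″ , i≤q , q≤i
      where
      q<1+k : q < suc k
      q<1+k = All.lookup bounded q∈L
      q→1+k : E q (suc k) ≡ true
      q→1+k = arc-shortenʳ (arc-shortenˡ e i≤q (ℕ.<-≤-trans q<1+k 1+k≤x)) q<1+k 1+k≤x
      q∈L″ : q ∈ L″
      q∈L″ = ∈-dropWhileᵇ (noArcTo (suc k)) q∈L (subst (T ∘ not) q→1+k)

    choose : ∀ L′ → L″ ≡ L′ → FrontChoice k L
    choose [] eq with covers″ (ℕ.n<1+n k) ℕ.≤-refl (E-consecutive k k<n)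
    ... | _ , q∈L″ , _ = contradiction (subst (_ ∈_) eq q∈L″) λ ()
    choose (f ∷ rest) eq = record
      { front     = f
      ; rest      = rest
      ; queue≡    = eq
      ; front-arc = Equivalence.to T-≡ (¬T-not⇒T (dropWhileᵇ-head (noArcTo (suc k)) L eq))
      ; front-min = front-min
      ; invariant = record
        { bounded = subst (All (_< suc k)) eq (All.dropWhile⁺ (T? ∘ noArcTo (suc k)) bounded)
        ; sorted  = sorted″
        ; covers  = subst (Covers (suc k)) eq covers″
        }
      }
      where
      sorted″ : AllPairs _≺_ (f ∷ rest)
      sorted″ = subst (AllPairs _≺_) eq (AllPairs-dropWhileᵇ⁺ (noArcTo (suc k)) sorted)

      front-min : ∀ {i} → E i (suc k) ≡ true → key f ≤ℚ key i
      front-min e with covers″ (proj₁ (E-bounded _ _ e)) ℕ.≤-refl e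
      ... | q , q∈L″ , _ , q≤i with AllPairs-head sorted″ (subst (q ∈_) eq q∈L″)
      ...   | inj₁ refl = q≤i
      ...   | inj₂ f≺q  = ℚ.≤-trans (ℚ.<⇒≤ f≺q) q≤i

  module Iteration {k} (k<n : k < n) (inv : QueueInvariant k (Λ (run c E k))) where
    open FrontChoice (front-choice k<n (back-invariant inv)) public

    run-step : pot (run c E (suc k)) (suc k) ≡ pot (run c E k) front + arcCost c front (suc k)
             × Λ (run c E (suc k)) ≡ front ∷ rest
    run-step = step-front c E (suc k) (run c E k) queue≡

    front≤k : front ≤ k
    front≤k = ℕ.≤-pred (All.head (QueueInvariant.bounded invariant))

    dist-optimal : (∀ {y} → y ≤ k → IsMinPathWeight c E 0 y (dist y)) →
      IsMinPathWeight c E 0 (suc k) (dist (suc k))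
    dist-optimal opt =
      subst (IsMinPathWeight c E 0 (suc k)) (sym dist≡)
        (bellman c E dist (λ ()) front-arc (opt front≤k) λ {i} e →
          opt (ℕ.≤-pred (proj₁ (E-bounded i (suc k) e))) ,
          reducedPot-≤⇒arcCost-≤ c dist {front} {i} (suc k) (front-min e))
      where
      dist≡ : dist (suc k) ≡ dist front + arcCost c front (suc k)
      dist≡ = trans (proj₁ run-step) (cong (_+ arcCost c front (suc k)) (pot-run-stable c E front≤k))

  Reached : ℕ → Set
  Reached k = QueueInvariant k (Λ (run c E k)) × (∀ {y} → y ≤ k → IsMinPathWeight c E 0 y (dist y))

  reached : ∀ {k} → k ≤ n → Reached k
  reached {zero} _ =
    record { bounded = [] ; sorted = [] ; covers = λ () } ,
    λ { z≤n → minPathWeight-refl c E (λ i j e → proj₁ (E-bounded i j e)) 0 }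
  reached {suc k} k<n with reached (ℕ.<⇒≤ k<n)
  ... | inv , opt = subst (QueueInvariant (suc k)) (sym (proj₂ run-step)) invariant , opt′
    where
    open Iteration k<n inv
    opt′ : ∀ {y} → y ≤ suc k → IsMinPathWeight c E 0 y (dist y)
    opt′ y≤1+k with ℕ.m≤n⇒m<n∨m≡n y≤1+k
    ... | inj₁ y<1+k = opt (ℕ.≤-pred y<1+k)
    ... | inj₂ refl  = dist-optimal opt

corollary1 : (n : ℕ) (c : Cost) (E : ArcSet)
    → (∀ u v → u ≤ n → v ≤ n → 0ℚ ≤ℚ c u v)
    → (∀ i j → E i j ≡ true → i < j × j ≤ n)
    → (∀ i j → E i j ≡ true → suc i < j → E (suc i) j ≡ true)
    → (∀ i j → i < j → E i j ≡ false → j < n → E i (suc j) ≡ false)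
    → (∀ i → i < n → E i (suc i) ≡ true)
    → ∀ x → 1 ≤ x → x ≤ n
    → Σ ℕ (λ f → Σ (List ℕ) (λ q →
        queueAfterFront c E x (run c E (x ∸ 1)) ≡ f ∷ q
        × E f x ≡ true
        × pot (run c E x) x ≡ pot (run c E (x ∸ 1)) f + arcCost c f x
        × IsMinPathWeight c E 0 x (pot (run c E x) x)))
corollary1 n c E _ E-bounded E-shortenˡ E-shortenʳ E-consecutive (suc k) _ k<n =
  front , rest , queue≡ , front-arc , proj₁ run-step , dist-optimal (proj₂ reached-k)
  where
  open SplitQueue n c E E-bounded E-shortenˡ E-shortenʳ E-consecutive
  reached-k : Reached k
  reached-k = reached (ℕ.<⇒≤ k<n)
  open Iteration k<n (proj₁ reached-k)
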